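{- Let $a$ and $b$ be relatively prime positive integers and let $k \ge 1$ be an integer. Let $R_k(a,b)$ be the set of all nonnegative integers $j$ having exactly $k$ representations $j = ma + nb$ with $(m, n) \in \mathbb{Z}_{\ge 0}^2$, and let $s_k(a,b) = \sum_{j \in R_k(a,b)} j$. Then \[ s_k (a, b) \ = \ \tfrac 1 2 \, ab \left( 2abk - a - b \right) . \]
   Context: The number of representations of $j$ is the number of pairs $(m,n) \in \mathbb{Z}_{\ge 0}^2$ with $ma+nb=j$. -}

module Defs where

open import Data.Nat using (ℕ; suc; _+_; _*_; _≟_)
open import Data.Nat.Properties using ()
open import Data.List using (List; length; filter; upTo; cartesianProduct; map)
open import Data.Nat.ListAction using (sum)
open import Data.Product using (_×_; _,_)
open import Relation.Binary.PropositionalEquality using (_≡_)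

pairsUpTo : ℕ → List (ℕ × ℕ)
pairsUpTo j = cartesianProduct (upTo (suc j)) (upTo (suc j))

-- Number of representations j = m*a + n*b with (m , n) ∈ ℕ².
-- For positive a, b every such pair has m ≤ j and n ≤ j, so the
-- bounded search counts all representations.
reps : ℕ → ℕ → ℕ → ℕ
reps a b j = length (filter (λ p → Data.Product.proj₁ p * a + Data.Product.proj₂ p * b ≟ j) (pairsUpTo j))

sumRepsBelow : ℕ → ℕ → ℕ → ℕ → ℕ
sumRepsBelow a b k N = sum (filter (λ j → reps a b j ≟ k) (upTo N))

module Submission where

-- Two representations of the same
-- number differ by a multiple of (b, −a), so every represented j has a
-- unique canonical representation j = m₀a + n₀b with m₀ < b, and its
-- representations are exactly (m₀ + tb, n₀ − ta) for t ≤ ⌊n₀/a⌋; hence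
-- reps(m₀a + n₀b) = 1 + ⌊n₀/a⌋.  Consequently, for k = k'+1,
--   R_k = { m·a + (k'a + i)·b : m < b, i < a },
-- and this parametrisation by the box [0,b) × [0,a) is injective.  Summing
-- two arithmetic series over the box gives 2·s_k = ab(2abk − a − b).

open import Defs
open import Data.Nat using (ℕ; zero; suc; _+_; _*_; _∸_; _<_; _≤_; _≟_; _≤?_; s≤s)
open import Data.Nat.Properties
open import Data.Nat.Divisibility using (_∣_; ∣m+n∣m⇒∣n; n∣m*n)
open import Data.Nat.DivMod using (_/_; _%_; m≡m%n+[m/n]*n; m%n<n; +-distrib-/-∣ˡ; m*n/n≡m; m<n⇒m/n≡0; m/n*n≤m; /-monoˡ-≤)
open import Data.Nat.Coprimality using (Coprime; coprime-divisor) renaming (sym to coprime-sym)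
open import Data.Nat.ListAction using (sum)
open import Data.Nat.ListAction.Properties using (sum-↭; sum-++)
open import Data.List using (List; []; _∷_; [_]; _++_; _∷ʳ_; length; filter; upTo; cartesianProduct; map)
open import Data.List.Properties using (length-map; length-upTo; map-++; upTo-∷ʳ)
open import Data.List.Membership.Propositional using (_∈_)
open import Data.List.Membership.Propositional.Properties using (∈-map⁺; ∈-map⁻; ∈-filter⁺; ∈-filter⁻; ∈-upTo⁺; ∈-upTo⁻; ∈-cartesianProduct⁺; ∈-cartesianProduct⁻)
open import Data.List.Membership.Propositional.Properties.WithK using (unique∧set⇒bag)
open import Data.List.Relation.Unary.Any using (here; there)
import Data.List.Relation.Unary.All as All
open import Data.List.Relation.Unary.AllPairs using ([]; _∷_)
open import Data.List.Relation.Unary.Unique.Propositional using (Unique)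
import Data.List.Relation.Unary.Unique.Propositional.Properties as Unique
open import Data.List.Relation.Binary.Permutation.Propositional using (_↭_)
open import Data.List.Relation.Binary.Permutation.Propositional.Properties using (↭-length)
open import Data.List.Relation.Binary.BagAndSetEquality using (∼bag⇒↭)
open import Function.Bundles using (mk⇔)
open import Data.Product using (Σ; _×_; _,_; proj₁; proj₂)
open import Relation.Nullary using (yes; no; contradiction)
open import Relation.Binary.PropositionalEquality using (_≡_; _≢_; refl; sym; trans; cong; cong₂; subst; module ≡-Reasoning)
open import Data.Nat.Tactic.RingSolver using (solve-∀)

open ≡-Reasoning

-- A map that is injective on the members of a duplicate-free list keeps it
-- duplicate-free (the library version asks for global injectivity).
Unique-map⁺-on : ∀ {A B : Set} (f : A → B) {xs : List A} →
  (∀ {x y} → x ∈ xs → y ∈ xs → f x ≡ f y → x ≡ y) → Unique xs → Unique (map f xs)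
Unique-map⁺-on f {[]} inj [] = []
Unique-map⁺-on f {x ∷ xs} inj (x∉xs ∷ u) =
  All.tabulate distinct ∷ Unique-map⁺-on f (λ x∈ y∈ → inj (there x∈) (there y∈)) u
  where
  distinct : ∀ {z} → z ∈ map f xs → f x ≢ z
  distinct z∈ fx≡z with ∈-map⁻ f z∈
  ... | y , y∈xs , refl = All.lookup x∉xs y∈xs (inj (here refl) (there y∈xs) fx≡z)

same-members⇒↭ : ∀ {A : Set} {xs ys : List A} → Unique xs → Unique ys →
  (∀ {x} → x ∈ xs → x ∈ ys) → (∀ {x} → x ∈ ys → x ∈ xs) → xs ↭ ys
same-members⇒↭ uxs uys to from = ∼bag⇒↭ (unique∧set⇒bag uxs uys (mk⇔ to from))

∈-of-length≢0 : ∀ {A : Set} (xs : List A) → length xs ≢ 0 → Σ A (_∈ xs)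
∈-of-length≢0 [] length≢0 = contradiction refl length≢0
∈-of-length≢0 (x ∷ xs) _ = x , here refl

sum-cartesianProduct : ∀ {A B : Set} (F : A → ℕ) (G : B → ℕ) (xs : List A) (ys : List B) →
  sum (map (λ p → F (proj₁ p) + G (proj₂ p)) (cartesianProduct xs ys))
    ≡ length ys * sum (map F xs) + length xs * sum (map G ys)
sum-cartesianProduct F G [] ys = sym (trans (+-identityʳ _) (*-zeroʳ (length ys)))
sum-cartesianProduct F G (x ∷ xs) ys = begin
    sum (map h (map (x ,_) ys ++ cartesianProduct xs ys))
  ≡⟨ cong sum (map-++ h (map (x ,_) ys) (cartesianProduct xs ys)) ⟩
    sum (map h (map (x ,_) ys) ++ map h (cartesianProduct xs ys))
  ≡⟨ sum-++ (map h (map (x ,_) ys)) (map h (cartesianProduct xs ys)) ⟩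
    sum (map h (map (x ,_) ys)) + sum (map h (cartesianProduct xs ys))
  ≡⟨ cong₂ _+_ (row ys) (sum-cartesianProduct F G xs ys) ⟩
    (length ys * F x + sum (map G ys)) + (length ys * sum (map F xs) + length xs * sum (map G ys))
  ≡⟨ regroup (length ys) (F x) (sum (map F xs)) (length xs) (sum (map G ys)) ⟩
    length ys * (F x + sum (map F xs)) + suc (length xs) * sum (map G ys) ∎
  where
  h : _ → ℕ
  h p = F (proj₁ p) + G (proj₂ p)
  row : ∀ ys → sum (map h (map (x ,_) ys)) ≡ length ys * F x + sum (map G ys)
  row [] = refl
  row (y ∷ ys) = trans (cong (F x + G y +_) (row ys)) (shuffle (F x) (G y) (length ys * F x) (sum (map G ys)))
    where
    shuffle : ∀ f g lf s → f + g + (lf + s) ≡ f + lf + (g + s)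
    shuffle = solve-∀
  regroup : ∀ l f sF lx sG → (l * f + sG) + (l * sF + lx * sG) ≡ l * (f + sF) + (1 + lx) * sG
  regroup = solve-∀

arith-sum : ∀ c v n → 2 * sum (map (λ i → (c + i) * v) (upTo (suc n))) ≡ (2 * c + n) * suc n * v
arith-sum c v zero = first c v
  where
  first : ∀ c v → 2 * ((c + 0) * v + 0) ≡ (2 * c + 0) * 1 * v
  first = solve-∀
arith-sum c v (suc n) = begin
    2 * sum (map f (upTo (suc (suc n))))
  ≡⟨ cong (λ l → 2 * sum (map f l)) (sym (upTo-∷ʳ (suc n))) ⟩
    2 * sum (map f (upTo (suc n) ∷ʳ suc n))
  ≡⟨ cong (λ l → 2 * sum l) (map-++ f (upTo (suc n)) [ suc n ]) ⟩
    2 * sum (map f (upTo (suc n)) ++ [ f (suc n) ])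
  ≡⟨ cong (2 *_) (sum-++ (map f (upTo (suc n))) [ f (suc n) ]) ⟩
    2 * (sum (map f (upTo (suc n))) + (f (suc n) + 0))
  ≡⟨ *-distribˡ-+ 2 (sum (map f (upTo (suc n)))) (f (suc n) + 0) ⟩
    2 * sum (map f (upTo (suc n))) + 2 * (f (suc n) + 0)
  ≡⟨ cong (_+ 2 * (f (suc n) + 0)) (arith-sum c v n) ⟩
    (2 * c + n) * suc n * v + 2 * ((c + suc n) * v + 0)
  ≡⟨ next c v n ⟩
    (2 * c + suc n) * suc (suc n) * v ∎
  where
  f : ℕ → ℕ
  f i = (c + i) * v
  next : ∀ c v n → (2 * c + n) * (1 + n) * v + 2 * ((c + (1 + n)) * v + 0)
                   ≡ (2 * c + (1 + n)) * (2 + n) * v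
  next = solve-∀

-- Representations by a fixed coprime pair, written a = a'+1, b = b'+1 so
-- that both are visibly nonzero (needed for division and cancellation).
module Representations (a' b' : ℕ) (coprime : Coprime (suc a') (suc b')) where

  a b : ℕ
  a = suc a'
  b = suc b'

  -- If n·b = d·a + n'·b then b ∣ d·a, hence b ∣ d by coprimality.
  b∣coefficient : ∀ {d n n'} → n * b ≡ d * a + n' * b → b ∣ d
  b∣coefficient {d} {n} {n'} eq = coprime-divisor (coprime-sym coprime) b∣a*d
    where
    b∣sum : b ∣ n' * b + d * a
    b∣sum = subst (b ∣_) (trans eq (+-comm (d * a) (n' * b))) (n∣m*n n)
    b∣a*d : b ∣ a * d
    b∣a*d = subst (b ∣_) (*-comm d a) (∣m+n∣m⇒∣n b∣sum (n∣m*n n'))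

  ShiftOf : ℕ → ℕ → ℕ → ℕ → Set
  ShiftOf m n m₀ n₀ = Σ ℕ λ t → (m ≡ m₀ + t * b) × (n + t * a ≡ n₀)

  exchange : ∀ m n m' n' → m ≤ m' → m * a + n * b ≡ m' * a + n' * b → ShiftOf m' n' m n
  exchange m n m' n' m≤m' eq = t , trans m'≡m+d (cong (m +_) d≡t*b) , n'+ta≡n
    where
    d = m' ∸ m
    m'≡m+d : m' ≡ m + d
    m'≡m+d = sym (m+[n∸m]≡n m≤m')
    nb≡ : n * b ≡ d * a + n' * b
    nb≡ = +-cancelˡ-≡ (m * a) _ _ (begin
      m * a + n * b            ≡⟨ eq ⟩
      m' * a + n' * b          ≡⟨ cong (λ x → x * a + n' * b) m'≡m+d ⟩
      (m + d) * a + n' * b     ≡⟨ regroup m d a (n' * b) ⟩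
      m * a + (d * a + n' * b) ∎)
      where
      regroup : ∀ m d a z → (m + d) * a + z ≡ m * a + (d * a + z)
      regroup = solve-∀
    b∣d : b ∣ d
    b∣d = b∣coefficient {d} {n} {n'} nb≡
    t = _∣_.quotient b∣d
    d≡t*b : d ≡ t * b
    d≡t*b = _∣_.equality b∣d
    n'+ta≡n : n' + t * a ≡ n
    n'+ta≡n = *-cancelʳ-≡ _ _ b (begin
      (n' + t * a) * b   ≡⟨ regroup n' t a b ⟩
      t * b * a + n' * b ≡⟨ cong (λ x → x * a + n' * b) (sym d≡t*b) ⟩
      d * a + n' * b     ≡⟨ sym nb≡ ⟩
      n * b              ∎)
      where
      regroup : ∀ n' t a b → (n' + t * a) * b ≡ t * b * a + n' * b
      regroup = solve-∀

  b≤shifted : ∀ {m m₀} t → m ≡ m₀ + suc t * b → b ≤ m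
  b≤shifted {m₀ = m₀} t m≡ = subst (b ≤_) (sym m≡) (≤-trans (m≤m+n b (t * b)) (m≤n+m _ m₀))

  -- Against a canonical representation (m₀ < b) every representation is a
  -- shift: the reverse shift would need m < m₀ < b and m₀ ≥ m + b.
  shift-from-canonical : ∀ m n m₀ n₀ → m₀ < b → m * a + n * b ≡ m₀ * a + n₀ * b →
    ShiftOf m n m₀ n₀
  shift-from-canonical m n m₀ n₀ m₀<b eq with m₀ ≤? m
  ... | yes m₀≤m = exchange m₀ n₀ m n m₀≤m (sym eq)
  ... | no m₀≰m = impossible (exchange m n m₀ n₀ (<⇒≤ m<m₀) eq)
    where
    m<m₀ : m < m₀
    m<m₀ = ≰⇒> m₀≰m
    impossible : ShiftOf m₀ n₀ m n → ShiftOf m n m₀ n₀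
    impossible (zero , m₀≡m+0 , _) =
      contradiction (subst (m <_) m₀≡m+0 m<m₀) (<-irrefl (sym (+-identityʳ m)))
    impossible (suc t , m₀≡ , _) = contradiction (b≤shifted t m₀≡) (<⇒≱ m₀<b)

  Reps : ℕ → List (ℕ × ℕ)
  Reps j = filter (λ p → proj₁ p * a + proj₂ p * b ≟ j) (pairsUpTo j)

  Reps-unique : ∀ j → Unique (Reps j)
  Reps-unique j = Unique.filter⁺ (λ p → proj₁ p * a + proj₂ p * b ≟ j)
    (Unique.cartesianProduct⁺ (Unique.upTo⁺ (suc j)) (Unique.upTo⁺ (suc j)))

  ∈Reps⁻ : ∀ {j p} → p ∈ Reps j → proj₁ p * a + proj₂ p * b ≡ j
  ∈Reps⁻ {j} p∈ = proj₂ (∈-filter⁻ (λ p → proj₁ p * a + proj₂ p * b ≟ j) {xs = pairsUpTo j} p∈)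

  -- Both coefficients of a representation of j are at most j (a, b ≥ 1),
  -- so the bounded search of `reps` finds every representation.
  ∈Reps⁺ : ∀ {j m n} → m * a + n * b ≡ j → (m , n) ∈ Reps j
  ∈Reps⁺ {j} {m} {n} eq = ∈-filter⁺ (λ p → proj₁ p * a + proj₂ p * b ≟ j)
    (∈-cartesianProduct⁺ (∈-upTo⁺ (s≤s m≤j)) (∈-upTo⁺ (s≤s n≤j))) eq
    where
    m≤j : m ≤ j
    m≤j = ≤-trans (m≤m*n m a) (subst (m * a ≤_) eq (m≤m+n _ _))
    n≤j : n ≤ j
    n≤j = ≤-trans (m≤m*n n b) (subst (n * b ≤_) eq (m≤n+m _ _))

  -- The representations of m₀a + n₀b (m₀ < b) are (m₀ + tb, n₀ − ta), t ≤ ⌊n₀/a⌋.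
  reps-canonical : ∀ {m₀} n₀ → m₀ < b → reps a b (m₀ * a + n₀ * b) ≡ suc (n₀ / a)
  reps-canonical {m₀} n₀ m₀<b = begin
    length (Reps j)                          ≡⟨ ↭-length Reps↭shifts ⟩
    length (map shift (upTo (suc (n₀ / a)))) ≡⟨ length-map shift (upTo (suc (n₀ / a))) ⟩
    length (upTo (suc (n₀ / a)))             ≡⟨ length-upTo (suc (n₀ / a)) ⟩
    suc (n₀ / a)                             ∎
    where
    j = m₀ * a + n₀ * b
    shift : ℕ → ℕ × ℕ
    shift t = (m₀ + t * b , n₀ ∸ t * a)
    shift-injective : ∀ {t u} → shift t ≡ shift u → t ≡ u
    shift-injective {t} {u} eq = *-cancelʳ-≡ t u b (+-cancelˡ-≡ m₀ _ _ (cong proj₁ eq))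
    -- n₀ − ta stays nonnegative exactly for t ≤ ⌊n₀/a⌋
    shift∈ : ∀ {m n} → ShiftOf m n m₀ n₀ → (m , n) ∈ map shift (upTo (suc (n₀ / a)))
    shift∈ {m} {n} (t , m≡ , n+ta≡n₀) =
      subst (_∈ map shift (upTo (suc (n₀ / a)))) (sym p≡) (∈-map⁺ shift (∈-upTo⁺ (s≤s t≤q)))
      where
      t≤q : t ≤ n₀ / a
      t≤q = subst (_≤ n₀ / a) (m*n/n≡m t a) (/-monoˡ-≤ a (subst (t * a ≤_) n+ta≡n₀ (m≤n+m (t * a) n)))
      p≡ : (m , n) ≡ shift t
      p≡ = cong₂ _,_ m≡ (sym (trans (cong (_∸ t * a) (sym n+ta≡n₀)) (m+n∸n≡m n (t * a))))
    to : ∀ {p} → p ∈ Reps j → p ∈ map shift (upTo (suc (n₀ / a)))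
    to {m , n} p∈ = shift∈ (shift-from-canonical m n m₀ n₀ m₀<b (∈Reps⁻ p∈))
    from : ∀ {p} → p ∈ map shift (upTo (suc (n₀ / a))) → p ∈ Reps j
    from p∈ with ∈-map⁻ shift {xs = upTo (suc (n₀ / a))} p∈
    ... | t , t∈ , refl = ∈Reps⁺ (begin
      (m₀ + t * b) * a + (n₀ ∸ t * a) * b   ≡⟨ regroup m₀ t b a (n₀ ∸ t * a) ⟩
      m₀ * a + (t * a + (n₀ ∸ t * a)) * b   ≡⟨ cong (λ x → m₀ * a + x * b) (m+[n∸m]≡n ta≤n₀) ⟩
      j                                     ∎)
      where
      ta≤n₀ : t * a ≤ n₀
      ta≤n₀ with s≤s t≤q ← ∈-upTo⁻ t∈ = ≤-trans (*-monoˡ-≤ a t≤q) (m/n*n≤m n₀ a)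
      regroup : ∀ m₀ t b a e → (m₀ + t * b) * a + e * b ≡ m₀ * a + (t * a + e) * b
      regroup = solve-∀
    Reps↭shifts : Reps j ↭ map shift (upTo (suc (n₀ / a)))
    Reps↭shifts = same-members⇒↭ (Reps-unique j) (Unique.map⁺ shift-injective (Unique.upTo⁺ _)) to from

  Canonical : ℕ → Set
  Canonical j = Σ ℕ λ m₀ → Σ ℕ λ n₀ → (m₀ < b) × (j ≡ m₀ * a + n₀ * b)

  -- Every represented number has a canonical representation: reduce m mod b.
  canonical-form : ∀ j → reps a b j ≢ 0 → Canonical j
  canonical-form j reps≢0 = reduce (∈-of-length≢0 (Reps j) reps≢0)
    where
    reduce : Σ (ℕ × ℕ) (_∈ Reps j) → Canonical j
    reduce ((m , n) , p∈) = m % b , n + m / b * a , m%n<n m b , (begin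
      j                                  ≡⟨ sym (∈Reps⁻ p∈) ⟩
      m * a + n * b                      ≡⟨ cong (λ x → x * a + n * b) (m≡m%n+[m/n]*n m b) ⟩
      (m % b + m / b * b) * a + n * b    ≡⟨ regroup (m % b) (m / b) b a n ⟩
      m % b * a + (n + m / b * a) * b    ∎)
      where
      regroup : ∀ r q b a n → (r + q * b) * a + n * b ≡ r * a + (n + q * a) * b
      regroup = solve-∀

  module Level (k' : ℕ) where

    -- R_{k'+1} is parametrised by the box [0,b) × [0,a) via point.
    box : List (ℕ × ℕ)
    box = cartesianProduct (upTo b) (upTo a)

    point : ℕ × ℕ → ℕ
    point p = proj₁ p * a + (k' * a + proj₂ p) * b

    BoxPoint : ℕ → Set
    BoxPoint j = Σ ℕ λ m → Σ ℕ λ i → (m < b) × (i < a) × (j ≡ point (m , i))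

    -- one past the largest point, point (b', a')
    N : ℕ
    N = suc (b' * a + (k' * a + a') * b)

    ∈box⁻ : ∀ {m i} → (m , i) ∈ box → m < b × i < a
    ∈box⁻ p∈ with m∈ , i∈ ← ∈-cartesianProduct⁻ (upTo b) (upTo a) p∈ = ∈-upTo⁻ m∈ , ∈-upTo⁻ i∈

    BoxPoint⇒<N : ∀ {j} → BoxPoint j → j < N
    BoxPoint⇒<N (m , i , s≤s m≤b' , s≤s i≤a' , refl) =
      s≤s (+-mono-≤ (*-monoˡ-≤ a m≤b') (*-monoˡ-≤ b (+-monoʳ-≤ (k' * a) i≤a')))

    BoxPoint⇒∈points : ∀ {j} → BoxPoint j → j ∈ map point box
    BoxPoint⇒∈points (m , i , m<b , i<a , refl) =
      ∈-map⁺ point (∈-cartesianProduct⁺ (∈-upTo⁺ m<b) (∈-upTo⁺ i<a))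

    -- A point is canonical with n₀ = k'a + i, and ⌊(k'a + i)/a⌋ = k'.
    reps-point : ∀ {m i} → m < b → i < a → reps a b (point (m , i)) ≡ suc k'
    reps-point {m} {i} m<b i<a = trans (reps-canonical (k' * a + i) m<b) (cong suc quotient≡k')
      where
      quotient≡k' : (k' * a + i) / a ≡ k'
      quotient≡k' = begin
        (k' * a + i) / a       ≡⟨ +-distrib-/-∣ˡ i (n∣m*n k') ⟩
        k' * a / a + i / a     ≡⟨ cong₂ _+_ (m*n/n≡m k' a) (m<n⇒m/n≡0 i<a) ⟩
        k' + 0                 ≡⟨ +-identityʳ k' ⟩
        k'                     ∎

    -- Conversely every number with k'+1 representations is a point: its
    -- canonical n₀ has ⌊n₀/a⌋ = k', so n₀ = k'a + (n₀ mod a).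
    reps⇒point : ∀ j → reps a b j ≡ suc k' → BoxPoint j
    reps⇒point j reps≡ = from-canonical (canonical-form j (λ reps≡0 → 0≢1+n (trans (sym reps≡0) reps≡)))
      where
      from-canonical : Canonical j → BoxPoint j
      from-canonical (m₀ , n₀ , m₀<b , j≡) =
        m₀ , n₀ % a , m₀<b , m%n<n n₀ a , trans j≡ (cong (λ x → m₀ * a + x * b) n₀≡)
        where
        quotient≡k' : n₀ / a ≡ k'
        quotient≡k' = suc-injective (trans (sym (reps-canonical n₀ m₀<b)) (subst (λ x → reps a b x ≡ suc k') j≡ reps≡))
        n₀≡ : n₀ ≡ k' * a + n₀ % a
        n₀≡ = begin
          n₀                   ≡⟨ m≡m%n+[m/n]*n n₀ a ⟩
          n₀ % a + n₀ / a * a  ≡⟨ cong (λ x → n₀ % a + x * a) quotient≡k' ⟩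
          n₀ % a + k' * a      ≡⟨ +-comm (n₀ % a) (k' * a) ⟩
          k' * a + n₀ % a      ∎

    -- Distinct box elements give distinct points: a shift by t ≥ 1 leaves [0,b).
    point-injective : ∀ {p q} → p ∈ box → q ∈ box → point p ≡ point q → p ≡ q
    point-injective {m , i} {m' , i'} p∈ q∈ eq =
      unshifted (shift-from-canonical m (k' * a + i) m' (k' * a + i') (proj₁ (∈box⁻ q∈)) eq)
      where
      unshifted : ShiftOf m (k' * a + i) m' (k' * a + i') → (m , i) ≡ (m' , i')
      unshifted (zero , m≡m'+0 , n≡) = cong₂ _,_ (trans m≡m'+0 (+-identityʳ m'))
        (+-cancelˡ-≡ (k' * a) _ _ (trans (sym (+-identityʳ _)) n≡))
      unshifted (suc t , m≡ , _) = contradiction (b≤shifted t m≡) (<⇒≱ (proj₁ (∈box⁻ p∈)))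

    R↭points : filter (λ j → reps a b j ≟ suc k') (upTo N) ↭ map point box
    R↭points = same-members⇒↭
      (Unique.filter⁺ (λ j → reps a b j ≟ suc k') (Unique.upTo⁺ N))
      (Unique-map⁺-on point point-injective (Unique.cartesianProduct⁺ (Unique.upTo⁺ b) (Unique.upTo⁺ a)))
      to from
      where
      to : ∀ {j} → j ∈ filter (λ j → reps a b j ≟ suc k') (upTo N) → j ∈ map point box
      to {j} j∈ = BoxPoint⇒∈points (reps⇒point j (proj₂ (∈-filter⁻ (λ j → reps a b j ≟ suc k') {xs = upTo N} j∈)))
      from : ∀ {j} → j ∈ map point box → j ∈ filter (λ j → reps a b j ≟ suc k') (upTo N)
      from j∈ with ∈-map⁻ point {xs = box} j∈
      ... | (m , i) , p∈ , refl with m<b , i<a ← ∈box⁻ p∈ =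
        ∈-filter⁺ (λ j → reps a b j ≟ suc k') (∈-upTo⁺ (BoxPoint⇒<N (m , i , m<b , i<a , refl))) (reps-point m<b i<a)

    closed-form : 2 * a * b * suc k' ∸ a ∸ b ≡ 2 * a * b * k' + a * b' + a' * b
    closed-form = begin
      2 * a * b * suc k' ∸ a ∸ b   ≡⟨ cong (λ x → x ∸ a ∸ b) (expand a' b' k') ⟩
      X + b + a ∸ a ∸ b            ≡⟨ cong (_∸ b) (m+n∸n≡m (X + b) a) ⟩
      X + b ∸ b                    ≡⟨ m+n∸n≡m X b ⟩
      X                            ∎
      where
      X = 2 * a * b * k' + a * b' + a' * b
      expand : ∀ a' b' k' → 2 * (1 + a') * (1 + b') * (1 + k')
        ≡ 2 * (1 + a') * (1 + b') * k' + (1 + a') * b' + a' * (1 + b') + (1 + b') + (1 + a')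
      expand = solve-∀

    sum-points : 2 * sum (map point box) ≡ a * b * (2 * a * b * suc k' ∸ a ∸ b)
    sum-points = begin
        2 * sum (map point box)
      ≡⟨ cong (2 *_) (sum-cartesianProduct F G (upTo b) (upTo a)) ⟩
        2 * (length (upTo a) * sum (map F (upTo b)) + length (upTo b) * sum (map G (upTo a)))
      ≡⟨ cong₂ (λ x y → 2 * (x * sum (map F (upTo b)) + y * sum (map G (upTo a)))) (length-upTo a) (length-upTo b) ⟩
        2 * (a * sum (map F (upTo b)) + b * sum (map G (upTo a)))
      ≡⟨ double a b (sum (map F (upTo b))) (sum (map G (upTo a))) ⟩
        a * (2 * sum (map F (upTo b))) + b * (2 * sum (map G (upTo a)))
      ≡⟨ cong₂ (λ x y → a * x + b * y) (arith-sum 0 a b') (arith-sum (k' * a) b a') ⟩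
        a * ((2 * 0 + b') * b * a) + b * ((2 * (k' * a) + a') * a * b)
      ≡⟨ collect a' b' k' ⟩
        a * b * (2 * a * b * k' + a * b' + a' * b)
      ≡⟨ cong (a * b *_) (sym closed-form) ⟩
        a * b * (2 * a * b * suc k' ∸ a ∸ b) ∎
      where
      F G : ℕ → ℕ
      F m = m * a
      G i = (k' * a + i) * b
      double : ∀ a b x y → 2 * (a * x + b * y) ≡ a * (2 * x) + b * (2 * y)
      double = solve-∀
      collect : ∀ a' b' k' →
        (1 + a') * ((2 * 0 + b') * (1 + b') * (1 + a'))
          + (1 + b') * ((2 * (k' * (1 + a')) + a') * (1 + a') * (1 + b'))
        ≡ (1 + a') * (1 + b') * (2 * (1 + a') * (1 + b') * k' + (1 + a') * b' + a' * (1 + b'))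
      collect = solve-∀

corollary3 : (a b k : ℕ) → 0 < a → 0 < b → Coprime a b → 1 ≤ k →
    Σ ℕ (λ N → ((j : ℕ) → reps a b j ≡ k → j < N)
    × (2 * sumRepsBelow a b k N ≡ a * b * (2 * a * b * k ∸ a ∸ b)))
corollary3 (suc a') (suc b') (suc k') _ _ coprime _ = N , R-bounded , sum-R
  where
  open Representations a' b' coprime
  open Level k'
  R-bounded : (j : ℕ) → reps a b j ≡ suc k' → j < N
  R-bounded j reps≡ = BoxPoint⇒<N (reps⇒point j reps≡)
  sum-R : 2 * sumRepsBelow a b (suc k') N ≡ a * b * (2 * a * b * suc k' ∸ a ∸ b)
  sum-R = trans (cong (2 *_) (sum-↭ R↭points)) sum-points
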